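{- Let $m \ge 2$, let $G_1,\dots,G_m$ be vertex-disjoint stars with $G_i \cong K_{1,n_i}$, $n_i \ge 1$, with center $s^i_0$ and leaves $s^i_1,\dots,s^i_{n_i}$, and let $S''$ be a (possibly empty) set of further isolated vertices. Let $S=\{s^1_0,\dots,s^m_0\}$, $S'=\bigcup_{i=1}^m\{s^i_1,\dots,s^i_{n_i}\}$, and let $T$ be the disjoint union of $G_1,\dots,G_m$ and the isolated vertices of $S''$. Let $B$ be the graph obtained from the complement $\overline{T}$ of $T$ by adding a new vertex $b$ (the head of $B$) and joining $b$ to every vertex of $S'$. Then $B$ has a hamiltonian path having $b$ as one of its ends.
   Context: Graphs are finite and simple. The complement $\overline{T}$ of $T$ has the same vertex set as $T$, with two vertices adjacent exactly when they are non-adjacent in $T$. The class of all graphs $B$ obtained by this construction is denoted $\mathcal{B}_1$. A hamiltonian path is a path through all vertices. -}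

module Defs where

open import Data.Nat using (ℕ)
open import Data.Fin using (Fin)
open import Data.Empty using (⊥)
open import Data.Unit using (⊤)
open import Data.Product using (_×_; ∃)
open import Data.Sum using (_⊎_)
open import Data.List using (List; _∷_; _∷ʳ_)
open import Data.List.Membership.Propositional using (_∈_)
open import Data.List.Relation.Unary.Unique.Propositional using (Unique)
open import Data.List.Relation.Unary.Linked using (Linked)
open import Relation.Binary.PropositionalEquality using (_≡_; _≢_)
open import Relation.Nullary using (¬_)

-- Vertices of T: m stars G_i ≅ K_{1,n i} (center s^i_0, leaves s^i_1..s^i_{n i})
-- plus k isolated vertices (the set S'').
data TV (m : ℕ) (n : Fin m → ℕ) (k : ℕ) : Set where
  center : Fin m → TV m n k
  leaf   : (i : Fin m) → Fin (n i) → TV m n k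
  iso    : Fin k → TV m n k

TAdj : ∀ {m n k} → TV m n k → TV m n k → Set
TAdj (center i) (leaf i' _) = i ≡ i'
TAdj (leaf i _) (center i') = i ≡ i'
TAdj _ _ = ⊥

CoAdj : ∀ {m n k} → TV m n k → TV m n k → Set
CoAdj x y = x ≢ y × ¬ TAdj x y

data BV (m : ℕ) (n : Fin m → ℕ) (k : ℕ) : Set where
  hd  : BV m n k
  old : TV m n k → BV m n k

BAdj : ∀ {m n k} → BV m n k → BV m n k → Set
BAdj hd (old (leaf _ _)) = ⊤
BAdj (old (leaf _ _)) hd = ⊤
BAdj (old x) (old y) = CoAdj x y
BAdj _ _ = ⊥

IsHamPath : {V : Set} → (V → V → Set) → List V → Set
IsHamPath {V} adj p = Unique p × (∀ v → v ∈ p) × Linked adj p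

IsEnd : {V : Set} → V → List V → Set
IsEnd v p = (∃ λ r → p ≡ v ∷ r) ⊎ (∃ λ r → p ≡ r ∷ʳ v)

-- In T every edge joins a centre to a leaf, so in B both {b} ∪ S' and S ∪ S'' are cliques.
-- A hamiltonian path therefore runs from b through all the leaves and then through all
-- centres and isolated vertices; the one edge it needs between the two cliques joins a
-- leaf of a star other than the first to the centre of the first star, which exists as m ≥ 2.
module Submission where

open import Defs
open import Data.Nat using (ℕ; _≤_; suc; s≤s; z≤n)
open import Data.Fin using (Fin; zero; suc)
open import Data.Product using (∃; _×_; _,_)
open import Data.Sum using (inj₁)
open import Data.Unit using (tt)
open import Data.Maybe using (just)
import Data.Maybe.Relation.Unary.All as Maybe
open import Data.Maybe.Relation.Binary.Connected using (Connected; just; nothing-just)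
open import Data.List using (List; []; _∷_; _++_; last; tabulate; allFin; concatMap)
open import Data.List.Properties using (++-conicalˡ)
open import Data.List.Relation.Unary.All as All using (All; []; _∷_)
import Data.List.Relation.Unary.All.Properties as All
import Data.List.Relation.Unary.AllPairs as AllPairs
import Data.List.Relation.Unary.AllPairs.Properties as AllPairs
open import Data.List.Relation.Unary.Any using (here; there)
open import Data.List.Relation.Unary.Unique.Propositional using (Unique; _∷_)
import Data.List.Relation.Unary.Unique.Propositional.Properties as Unique
open import Data.List.Relation.Unary.Linked using (Linked; []; [-]; _∷_)
import Data.List.Relation.Unary.Linked.Properties as Linked
open import Data.List.Relation.Binary.Disjoint.Propositional using (Disjoint)
open import Data.List.Membership.Propositional using (_∈_)
open import Data.List.Membership.Propositional.Properties
  using (∈-tabulate⁺; ∈-tabulate⁻; ∈-allFin; ∈-concat⁺′; ∈-map⁺; ∈-++⁺ˡ; ∈-++⁺ʳ)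
open import Relation.Binary.PropositionalEquality using (_≡_; _≢_; refl; cong; subst; sym)
open import Relation.Nullary using (¬_; contradiction)

module _ {A : Set} where

  last-++ : ∀ (xs : List A) {ys} → ys ≢ [] → last (xs ++ ys) ≡ last ys
  last-++ []               ys≢[] = refl
  last-++ (_ ∷ [])         {[]}    ys≢[] = contradiction refl ys≢[]
  last-++ (_ ∷ [])         {_ ∷ _} _     = refl
  last-++ (_ ∷ xs@(_ ∷ _)) ys≢[]         = last-++ xs ys≢[]

  tabulate-≢[] : ∀ {l} {f : Fin l → A} → 1 ≤ l → tabulate f ≢ []
  tabulate-≢[] {suc _} _ ()

  connected-to : ∀ {R : A → A → Set} {y mx} → Maybe.All (λ x → R x y) mx → Connected R mx (just y)
  connected-to (Maybe.just r) = just r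
  connected-to Maybe.nothing  = nothing-just

  linked-in-clique : ∀ {P : A → Set} {R : A → A → Set} → (∀ {x y} → P x → P y → x ≢ y → R x y) →
                     ∀ {xs} → All P xs → Unique xs → Linked R xs
  linked-in-clique clique []                 _                   = []
  linked-in-clique clique (_ ∷ [])           _                   = [-]
  linked-in-clique clique (px ∷ py ∷ pxs) ((x≢y ∷ _) ∷ unique) =
    clique px py x≢y ∷ linked-in-clique clique (py ∷ pxs) unique

module _ {m : ℕ} {n : Fin m → ℕ} {k : ℕ} where

  data LeafOrHead : BV m n k → Set where
    is-hd   : LeafOrHead hd
    is-leaf : ∀ i j → LeafOrHead (old (leaf i j))

  data CenterOrIsolated : BV m n k → Set where
    is-center : ∀ i → CenterOrIsolated (old (center i))
    is-iso    : ∀ i → CenterOrIsolated (old (iso i))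

  leafOrHead-adjacent : ∀ {x y} → LeafOrHead x → LeafOrHead y → x ≢ y → BAdj x y
  leafOrHead-adjacent is-hd         is-hd         x≢y = contradiction refl x≢y
  leafOrHead-adjacent is-hd         (is-leaf _ _) _   = tt
  leafOrHead-adjacent (is-leaf _ _) is-hd         _   = tt
  leafOrHead-adjacent (is-leaf _ _) (is-leaf _ _) x≢y = (λ x≡y → x≢y (cong old x≡y)) , λ ()

  centerOrIsolated-adjacent : ∀ {x y} → CenterOrIsolated x → CenterOrIsolated y → x ≢ y → BAdj x y
  centerOrIsolated-adjacent (is-center _) (is-center _) x≢y = (λ x≡y → x≢y (cong old x≡y)) , λ ()
  centerOrIsolated-adjacent (is-center _) (is-iso _)    _   = (λ ()) , λ ()
  centerOrIsolated-adjacent (is-iso _)    (is-center _) _   = (λ ()) , λ ()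
  centerOrIsolated-adjacent (is-iso _)    (is-iso _)    x≢y = (λ x≡y → x≢y (cong old x≡y)) , λ ()

  leafOrHead⇒¬centerOrIsolated : ∀ {x} → LeafOrHead x → ¬ CenterOrIsolated x
  leafOrHead⇒¬centerOrIsolated is-hd         ()
  leafOrHead⇒¬centerOrIsolated (is-leaf _ _) ()

  leaf-center-adjacent : ∀ {i c} j → i ≢ c → BAdj {m} {n} {k} (old (leaf i j)) (old (center c))
  leaf-center-adjacent j i≢c = (λ ()) , i≢c

  leavesOf : Fin m → List (BV m n k)
  leavesOf i = tabulate (λ j → old (leaf i j))

  All-concatMap-leavesOf : ∀ {P : BV m n k → Set} {is} → All (λ i → ∀ j → P (old (leaf i j))) is →
                           All P (concatMap leavesOf is)
  All-concatMap-leavesOf P-leaves = All.concat⁺ (All.map⁺ {f = leavesOf} (All.map All.tabulate⁺ P-leaves))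

  leaves : List (BV m n k)
  leaves = concatMap leavesOf (allFin m)

  centers : List (BV m n k)
  centers = tabulate (λ i → old (center i))

  isolated : List (BV m n k)
  isolated = tabulate (λ i → old (iso i))

  centersAndIsolated : List (BV m n k)
  centersAndIsolated = centers ++ isolated

  headClique : List (BV m n k)
  headClique = hd ∷ leaves

  all-leafOrHead : All LeafOrHead headClique
  all-leafOrHead = is-hd ∷ All-concatMap-leavesOf (All.universal is-leaf (allFin m))

  all-centerOrIsolated : All CenterOrIsolated centersAndIsolated
  all-centerOrIsolated = All.++⁺ (All.tabulate⁺ is-center) (All.tabulate⁺ is-iso)

  leavesOf-disjoint : ∀ {i i'} → i ≢ i' → Disjoint (leavesOf i) (leavesOf i')
  leavesOf-disjoint i≢i' (v∈i , v∈i') with ∈-tabulate⁻ v∈i | ∈-tabulate⁻ v∈i'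
  ... | _ , refl | _ , refl = i≢i' refl

  headClique-unique : Unique headClique
  headClique-unique = hd∉leaves ∷ leaves-unique
    where
    hd∉leaves : All (hd ≢_) leaves
    hd∉leaves = All-concatMap-leavesOf (All.universal (λ _ _ ()) (allFin m))

    leaves-unique : Unique leaves
    leaves-unique =
      Unique.concat⁺ (All.map⁺ {f = leavesOf} (All.tabulate⁺ λ _ → Unique.tabulate⁺ λ { refl → refl }))
                     (AllPairs.map⁺ {f = leavesOf} (AllPairs.map leavesOf-disjoint (Unique.allFin⁺ m)))

  centersAndIsolated-unique : Unique centersAndIsolated
  centersAndIsolated-unique =
    Unique.++⁺ (Unique.tabulate⁺ λ { refl → refl }) (Unique.tabulate⁺ λ { refl → refl }) centers∩isolated
    where
    centers∩isolated : Disjoint centers isolated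
    centers∩isolated (v∈centers , v∈isolated)
      with ∈-tabulate⁻ {f = λ i → old (center i)} v∈centers | ∈-tabulate⁻ {f = λ i → old (iso i)} v∈isolated
    ... | _ , refl | _ , ()

  path-unique : Unique (headClique ++ centersAndIsolated)
  path-unique = Unique.++⁺ headClique-unique centersAndIsolated-unique λ (v∈head , v∈rest) →
    leafOrHead⇒¬centerOrIsolated (All.lookup all-leafOrHead v∈head) (All.lookup all-centerOrIsolated v∈rest)

  ∈-path : ∀ v → v ∈ headClique ++ centersAndIsolated
  ∈-path hd               = here refl
  ∈-path (old (leaf i j)) = there (∈-++⁺ˡ (∈-concat⁺′ (∈-tabulate⁺ j) (∈-map⁺ leavesOf (∈-allFin i))))
  ∈-path (old (center i)) = ∈-++⁺ʳ headClique (∈-++⁺ˡ (∈-tabulate⁺ i))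
  ∈-path (old (iso i))    = ∈-++⁺ʳ headClique (∈-++⁺ʳ _ (∈-tabulate⁺ i))

-- Listing the first star first makes the last leaf belong to another star.
last-leaf-adjacent-center₀ : ∀ {m} {n : Fin (suc (suc m)) → ℕ} {k} → 1 ≤ n (suc zero) →
  Connected BAdj (last (headClique {n = n} {k})) (just (old (center zero)))
last-leaf-adjacent-center₀ {n = n} {k} 1≤n₁ =
  subst (λ l → Connected BAdj l (just (old (center zero))))
        (sym (last-++ (hd ∷ leavesOf zero) otherLeaves≢[]))
        (connected-to (All.last⁺ otherLeaves-adjacent))
  where
  otherLeaves : List (BV _ n k)
  otherLeaves = concatMap leavesOf (tabulate suc)

  otherLeaves≢[] : otherLeaves ≢ []
  otherLeaves≢[] eq = tabulate-≢[] 1≤n₁ (++-conicalˡ (leavesOf (suc zero)) _ eq)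

  otherLeaves-adjacent : All (λ v → BAdj v (old (center zero))) otherLeaves
  otherLeaves-adjacent =
    All-concatMap-leavesOf (All.tabulate⁺ {f = suc} λ _ j → leaf-center-adjacent j λ ())

lemma4p1 : (m : ℕ) → 2 ≤ m → (n : Fin m → ℕ) → (∀ i → 1 ≤ n i) → (k : ℕ) →
    ∃ λ p → IsHamPath (BAdj {m} {n} {k}) p × IsEnd hd p
lemma4p1 (suc (suc m)) (s≤s (s≤s z≤n)) n 1≤n k =
  headClique ++ centersAndIsolated , (path-unique , ∈-path , linked) , inj₁ (_ , refl)
  where
  linked : Linked BAdj (headClique {n = n} {k} ++ centersAndIsolated)
  linked = Linked.++⁺
    (linked-in-clique leafOrHead-adjacent all-leafOrHead headClique-unique)
    (last-leaf-adjacent-center₀ (1≤n (suc zero)))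
    (linked-in-clique centerOrIsolated-adjacent all-centerOrIsolated centersAndIsolated-unique)
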